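{- When applied to a primary irreducible type $\tau$, the block algorithm produces a factorisation $\tau=B_1B_2\cdots B_b$ of $\tau$ into nonempty blocks $B_1,\dots,B_b$ with $b\ge 2$. Moreover, $\mathbf{1}(B_b)=0$.
   Context: For finite sets $X,Y\subseteq\mathbb{Q}$ with $X\cup Y=\{z_1<\dots<z_\ell\}$, the order type $\tau(X,Y)$ is the sequence $(\tau_1,\dots,\tau_\ell)$ with $\tau_i=1$ if $z_i\in X\setminus Y$, $2$ if $z_i\in Y\setminus X$, $3$ if $z_i\in X\cap Y$. A type of width $k$ is the order type of a pair $(X,Y)$ of finite subsets of $\mathbb{Q}$ with $|X|=|Y|=k$. A nonempty type is irreducible if it is not the concatenation of two nonempty types; it is primary if its first entry is $1$. For a finite sequence $B$ of ones, twos and threes, $\mathbf{1}(B)$ is the number of entries equal to $1$ or $3$ and $\mathbf{2}(B)$ the number equal to $2$ or $3$. The block algorithm on a primary irreducible type $\tau$, processing $\tau$ left to right: (i) the first block $B_1$ consists of all initial ones of $\tau$; (ii) if block $B_i$ has just been constructed, the next block $B_{i+1}$ consists of the next consecutive entries of $\tau$ such that $\mathbf{2}(B_{i+1})=\mathbf{1}(B_i)$ and, subject to this, $B_{i+1}$ is as long as possible; (iii) the algorithm stops when all entries of $\tau$ have been placed in a block. -}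

module Defs where

open import Data.Nat using (ℕ; zero; suc; _≤_)
open import Data.List using (List; []; _∷_; _++_; length)
open import Data.List.Relation.Unary.All using (All)
open import Data.List.Relation.Unary.Linked using (Linked)
open import Data.Rational using (ℚ; _<_)
open import Data.Rational.Properties using (<-cmp)
open import Data.Product using (Σ; ∃; _×_; _,_)
open import Relation.Binary.Definitions using (Tri; tri<; tri≈; tri>)
open import Relation.Binary.PropositionalEquality using (_≡_; _≢_)
open import Relation.Nullary using (¬_)

data Entry : Set where
  one two three : Entry

-- A finite subset of ℚ is represented by the strictly increasing list of its elements.
StrictlyIncreasing : List ℚ → Set
StrictlyIncreasing = Linked _<_

orderType : List ℚ → List ℚ → List Entry
mergeInto : ℚ → List ℚ → List ℚ → List Entry
compareStep : ∀ x xs y ys → Tri (x < y) (x ≡ y) (y < x) → List Entry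

orderType [] [] = []
orderType [] (y ∷ ys) = two ∷ orderType [] ys
orderType (x ∷ xs) ys = mergeInto x xs ys

mergeInto x xs [] = one ∷ orderType xs []
mergeInto x xs (y ∷ ys) = compareStep x xs y ys (<-cmp x y)

compareStep x xs y ys (tri< _ _ _) = one ∷ orderType xs (y ∷ ys)
compareStep x xs y ys (tri≈ _ _ _) = three ∷ orderType xs ys
compareStep x xs y ys (tri> _ _ _) = two ∷ mergeInto x xs ys

TypeOfWidth : ℕ → List Entry → Set
TypeOfWidth k τ = Σ (List ℚ) λ X → Σ (List ℚ) λ Y →
  StrictlyIncreasing X × StrictlyIncreasing Y ×
  length X ≡ k × length Y ≡ k × orderType X Y ≡ τ

IsType : List Entry → Set
IsType τ = ∃ λ k → TypeOfWidth k τ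

NonEmpty : List Entry → Set
NonEmpty τ = τ ≢ []

Irreducible : List Entry → Set
Irreducible τ = NonEmpty τ ×
  ¬ (Σ (List Entry) λ σ → Σ (List Entry) λ ρ →
       IsType σ × NonEmpty σ × IsType ρ × NonEmpty ρ × τ ≡ σ ++ ρ)

Primary : List Entry → Set
Primary [] = Data.Empty.⊥ where import Data.Empty
Primary (e ∷ _) = e ≡ one

count₁ : List Entry → ℕ
count₁ [] = 0
count₁ (one ∷ B) = suc (count₁ B)
count₁ (two ∷ B) = count₁ B
count₁ (three ∷ B) = suc (count₁ B)

count₂ : List Entry → ℕ
count₂ [] = 0
count₂ (one ∷ B) = count₂ B
count₂ (two ∷ B) = suc (count₂ B)
count₂ (three ∷ B) = suc (count₂ B)

LongestPrefix : ℕ → List Entry → List Entry → List Entry → Set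
LongestPrefix n rest B rest' =
  B ++ rest' ≡ rest × count₂ B ≡ n ×
  (∀ B″ r″ → B″ ++ r″ ≡ rest → count₂ B″ ≡ n → length B″ ≤ length B)

-- BlocksFrom prev rest Bs : having just built block prev, with `rest` still
-- unprocessed, the algorithm outputs the further blocks Bs and stops.
data BlocksFrom : List Entry → List Entry → List (List Entry) → Set where
  stop : ∀ {prev} → BlocksFrom prev [] []
  step : ∀ {prev e rest B rest' Bs} →
         LongestPrefix (count₁ prev) (e ∷ rest) B rest' →
         BlocksFrom B rest' Bs →
         BlocksFrom prev (e ∷ rest) (B ∷ Bs)

NotStartingWithOne : List Entry → Set
NotStartingWithOne [] = Data.Unit.⊤ where import Data.Unit
NotStartingWithOne (e ∷ _) = e ≢ one

data BlockAlgorithm (τ : List Entry) : List (List Entry) → Set where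
  run : ∀ {B₁ r Bs} → B₁ ++ r ≡ τ → All (_≡ one) B₁ → NotStartingWithOne r →
        BlocksFrom B₁ r Bs → BlockAlgorithm τ (B₁ ∷ Bs)

-- A sequence of ones, twos and threes is a type exactly when 𝟏 = 𝟐, so an
-- irreducible type τ has no proper nonempty balanced suffix. Along the block
-- algorithm the unprocessed rest of τ contains exactly 𝟏(B) more entries
-- counted by 𝟐 than by 𝟏, where B is the block just built. Hence 𝟏(B) ≤ 𝟐(rest),
-- so the next block exists; 𝟏(B) ≠ 0 while the rest is nonempty, since
-- otherwise the rest would be balanced, so every block is nonempty; and once
-- the rest is empty, 𝟏(B) = 0. The first block consists of ones only and has
-- 𝟏 ≠ 0, so it cannot be the last one.
module Submission where

open import Defs
open import Data.Nat using (_≤_)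
open import Data.List using (List; concat; length; _∷ʳ_)
open import Data.List.Relation.Unary.All using (All)
open import Data.Product using (Σ; ∃; _×_)
open import Relation.Binary.PropositionalEquality using (_≡_)

open import Data.Bool using (Bool; true; false; if_then_else_)
open import Data.Empty using (⊥-elim)
import Data.Integer as ℤ
import Data.Integer.Properties as ℤ
open import Data.List using ([]; _∷_; _++_; [_])
open import Data.List.Properties using (++-assoc; ++-conicalˡ; ∷-injective; length-++)
open import Data.List.Relation.Unary.All using ([]; _∷_)
open import Data.List.Relation.Unary.AllPairs using (AllPairs; []; _∷_)
open import Data.List.Relation.Unary.Linked.Properties using (AllPairs⇒Linked)
open import Data.Nat as ℕ using (ℕ; zero; suc; _+_; z≤n; s≤s)
open import Data.Nat.Induction using (<-wellFounded)
open import Data.Nat.Properties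
  using (+-cancelˡ-≡; +-cancelʳ-≡; +-identityʳ; m≤m+n; m≤n+m; n<1+n; m<n⇒m<1+n)
open import Data.Product using (∃₂; _,_; proj₁)
open import Data.Rational as ℚ using (ℚ; *<*)
open import Data.Rational.Literals using (fromℤ)
open import Data.Rational.Properties using (<-cmp; <-irrefl)
open import Data.Unit using (tt)
open import Induction.WellFounded using (Acc; acc)
open import Relation.Binary.Definitions using (tri<; tri≈; tri>)
open import Relation.Binary.PropositionalEquality
  using (_≢_; refl; sym; trans; cong; subst; subst₂; module ≡-Reasoning)
open import Relation.Nullary using (¬_)

open ≡-Reasoning

count₁-++ : ∀ A B → count₁ (A ++ B) ≡ count₁ A + count₁ B
count₁-++ [] B = refl
count₁-++ (one ∷ A) B = cong suc (count₁-++ A B)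
count₁-++ (two ∷ A) B = count₁-++ A B
count₁-++ (three ∷ A) B = cong suc (count₁-++ A B)

count₂-++ : ∀ A B → count₂ (A ++ B) ≡ count₂ A + count₂ B
count₂-++ [] B = refl
count₂-++ (one ∷ A) B = count₂-++ A B
count₂-++ (two ∷ A) B = cong suc (count₂-++ A B)
count₂-++ (three ∷ A) B = cong suc (count₂-++ A B)

Balanced : List Entry → Set
Balanced τ = count₁ τ ≡ count₂ τ

balanced-++-cancelʳ : ∀ A B → Balanced (A ++ B) → Balanced B → Balanced A
balanced-++-cancelʳ A B balAB balB = +-cancelʳ-≡ (count₁ B) (count₁ A) (count₂ A) (begin
  count₁ A + count₁ B  ≡⟨ count₁-++ A B ⟨
  count₁ (A ++ B)      ≡⟨ balAB ⟩
  count₂ (A ++ B)      ≡⟨ count₂-++ A B ⟩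
  count₂ A + count₂ B  ≡⟨ cong (count₂ A +_) balB ⟨
  count₂ A + count₁ B  ∎)

-- Types are exactly the balanced sequences

mutual
  count₁-orderType : ∀ X Y → count₁ (orderType X Y) ≡ length X
  count₁-orderType [] [] = refl
  count₁-orderType [] (y ∷ Y) = count₁-orderType [] Y
  count₁-orderType (x ∷ X) Y = count₁-mergeInto x X Y

  count₁-mergeInto : ∀ x X Y → count₁ (mergeInto x X Y) ≡ suc (length X)
  count₁-mergeInto x X [] = cong suc (count₁-orderType X [])
  count₁-mergeInto x X (y ∷ Y) with <-cmp x y
  ... | tri< _ _ _ = cong suc (count₁-orderType X (y ∷ Y))
  ... | tri≈ _ _ _ = cong suc (count₁-orderType X Y)
  ... | tri> _ _ _ = count₁-mergeInto x X Y

mutual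
  count₂-orderType : ∀ X Y → count₂ (orderType X Y) ≡ length Y
  count₂-orderType [] [] = refl
  count₂-orderType [] (y ∷ Y) = cong suc (count₂-orderType [] Y)
  count₂-orderType (x ∷ X) Y = count₂-mergeInto x X Y

  count₂-mergeInto : ∀ x X Y → count₂ (mergeInto x X Y) ≡ length Y
  count₂-mergeInto x X [] = count₂-orderType X []
  count₂-mergeInto x X (y ∷ Y) with <-cmp x y
  ... | tri< _ _ _ = count₂-orderType X (y ∷ Y)
  ... | tri≈ _ _ _ = cong suc (count₂-orderType X Y)
  ... | tri> _ _ _ = cong suc (count₂-mergeInto x X Y)

isType⇒balanced : ∀ {τ} → IsType τ → Balanced τ
isType⇒balanced (k , X , Y , _ , _ , |X|≡k , |Y|≡k , refl) = begin
  count₁ (orderType X Y)  ≡⟨ count₁-orderType X Y ⟩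
  length X                ≡⟨ trans |X|≡k (sym |Y|≡k) ⟩
  length Y                ≡⟨ count₂-orderType X Y ⟨
  count₂ (orderType X Y)  ∎

orderType-one : ∀ q X Y → All (q ℚ.<_) Y → orderType (q ∷ X) Y ≡ one ∷ orderType X Y
orderType-one q X [] _ = refl
orderType-one q X (y ∷ Y) (q<y ∷ _) with <-cmp q y
... | tri< _ _ _ = refl
... | tri≈ q≮y _ _ = ⊥-elim (q≮y q<y)
... | tri> q≮y _ _ = ⊥-elim (q≮y q<y)

orderType-two : ∀ q X Y → All (q ℚ.<_) X → orderType X (q ∷ Y) ≡ two ∷ orderType X Y
orderType-two q [] Y _ = refl
orderType-two q (x ∷ X) Y (q<x ∷ _) with <-cmp x q
... | tri< _ _ q≮x = ⊥-elim (q≮x q<x)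
... | tri≈ _ _ q≮x = ⊥-elim (q≮x q<x)
... | tri> _ _ _ = refl

orderType-three : ∀ q X Y → orderType (q ∷ X) (q ∷ Y) ≡ three ∷ orderType X Y
orderType-three q X Y with <-cmp q q
... | tri< q<q _ _ = ⊥-elim (<-irrefl refl q<q)
... | tri≈ _ _ _ = refl
... | tri> _ _ q<q = ⊥-elim (<-irrefl refl q<q)

rational : ℕ → ℚ
rational n = fromℤ (ℤ.+ n)

rational-mono-< : ∀ {m n} → m ℕ.< n → rational m ℚ.< rational n
rational-mono-< {m} {n} m<n =
  *<* (subst₂ ℤ._<_ (sym (ℤ.*-identityʳ (ℤ.+ m))) (sym (ℤ.*-identityʳ (ℤ.+ n))) (ℤ.+<+ m<n))

-- The i-th entry of a sequence is placed at the rational i; p selects the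
-- entries that belong to the set.
positions : (Entry → Bool) → ℕ → List Entry → List ℚ
positions p i [] = []
positions p i (e ∷ l) =
  if p e then rational i ∷ positions p (suc i) l else positions p (suc i) l

positions-above : ∀ p {i j} l → i ℕ.< j → All (rational i ℚ.<_) (positions p j l)
positions-above p [] i<j = []
positions-above p (e ∷ l) i<j with p e
... | true = rational-mono-< i<j ∷ positions-above p l (m<n⇒m<1+n i<j)
... | false = positions-above p l (m<n⇒m<1+n i<j)

positions-increasing : ∀ p i l → AllPairs ℚ._<_ (positions p i l)
positions-increasing p i [] = []
positions-increasing p i (e ∷ l) with p e
... | true = positions-above p l (n<1+n i) ∷ positions-increasing p (suc i) l
... | false = positions-increasing p (suc i) l

inX inY : Entry → Bool
inX one = true
inX two = false
inX three = true
inY one = false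
inY two = true
inY three = true

length-positions-inX : ∀ i l → length (positions inX i l) ≡ count₁ l
length-positions-inX i [] = refl
length-positions-inX i (one ∷ l) = cong suc (length-positions-inX (suc i) l)
length-positions-inX i (two ∷ l) = length-positions-inX (suc i) l
length-positions-inX i (three ∷ l) = cong suc (length-positions-inX (suc i) l)

length-positions-inY : ∀ i l → length (positions inY i l) ≡ count₂ l
length-positions-inY i [] = refl
length-positions-inY i (one ∷ l) = length-positions-inY (suc i) l
length-positions-inY i (two ∷ l) = cong suc (length-positions-inY (suc i) l)
length-positions-inY i (three ∷ l) = cong suc (length-positions-inY (suc i) l)

orderType-positions : ∀ i l → orderType (positions inX i l) (positions inY i l) ≡ l
orderType-positions i [] = refl
orderType-positions i (one ∷ l) =
  trans (orderType-one _ _ _ (positions-above inY l (n<1+n i)))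
        (cong (one ∷_) (orderType-positions (suc i) l))
orderType-positions i (two ∷ l) =
  trans (orderType-two _ _ _ (positions-above inX l (n<1+n i)))
        (cong (two ∷_) (orderType-positions (suc i) l))
orderType-positions i (three ∷ l) =
  trans (orderType-three _ _ _) (cong (three ∷_) (orderType-positions (suc i) l))

balanced⇒isType : ∀ {τ} → Balanced τ → IsType τ
balanced⇒isType {τ} bal =
  count₁ τ , positions inX 0 τ , positions inY 0 τ ,
  AllPairs⇒Linked (positions-increasing inX 0 τ) ,
  AllPairs⇒Linked (positions-increasing inY 0 τ) ,
  length-positions-inX 0 τ , trans (length-positions-inY 0 τ) (sym bal) ,
  orderType-positions 0 τ

longestPrefix-∷ : ∀ e {n l} B R → LongestPrefix n l B R →
                  LongestPrefix (count₂ [ e ] + n) (e ∷ l) (e ∷ B) R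
longestPrefix-∷ e {n} {l} B R (B++R≡l , count₂B≡n , maximal) =
  cong (e ∷_) B++R≡l , trans (count₂-++ [ e ] B) (cong (count₂ [ e ] +_) count₂B≡n) ,
  maximal′
  where
  maximal′ : ∀ B″ r″ → B″ ++ r″ ≡ e ∷ l → count₂ B″ ≡ count₂ [ e ] + n →
             length B″ ≤ suc (length B)
  maximal′ [] r″ _ _ = z≤n
  maximal′ (x ∷ B″) r″ eq count with ∷-injective eq
  ... | refl , B″++r″≡l = s≤s (maximal B″ r″ B″++r″≡l
          (+-cancelˡ-≡ (count₂ [ e ]) _ _ (trans (sym (count₂-++ [ e ] B″)) count)))

longestPrefix-[] : ∀ {e} l → e ≢ one → LongestPrefix 0 (e ∷ l) [] (e ∷ l)
longestPrefix-[] {e} l e≢one = refl , refl , maximal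
  where
  maximal : ∀ B″ r″ → B″ ++ r″ ≡ e ∷ l → count₂ B″ ≡ 0 → length B″ ≤ 0
  maximal [] _ _ _ = z≤n
  maximal (one ∷ _) _ refl _ = ⊥-elim (e≢one refl)
  maximal (two ∷ _) _ _ ()
  maximal (three ∷ _) _ _ ()

longestPrefix : ∀ n l → n ≤ count₂ l → ∃₂ (LongestPrefix n l)
longestPrefix zero [] z≤n = [] , [] , refl , refl , λ { [] _ _ _ → z≤n }
longestPrefix n (one ∷ l) n≤ with longestPrefix n l n≤
... | B , R , lp = one ∷ B , R , longestPrefix-∷ one B R lp
longestPrefix zero (two ∷ l) _ = [] , two ∷ l , longestPrefix-[] l (λ ())
longestPrefix (suc n) (two ∷ l) (s≤s n≤) with longestPrefix n l n≤
... | B , R , lp = two ∷ B , R , longestPrefix-∷ two B R lp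
longestPrefix zero (three ∷ l) _ = [] , three ∷ l , longestPrefix-[] l (λ ())
longestPrefix (suc n) (three ∷ l) (s≤s n≤) with longestPrefix n l n≤
... | B , R , lp = three ∷ B , R , longestPrefix-∷ three B R lp

longestPrefix-nonEmpty : ∀ {n l} B R → LongestPrefix n l B R → n ≢ 0 → NonEmpty B
longestPrefix-nonEmpty _ _ (_ , count₂B≡n , _) n≢0 refl = n≢0 (sym count₂B≡n)

suffix-shorter : ∀ B R {l} → NonEmpty B → B ++ R ≡ l → length R ℕ.< length l
suffix-shorter [] _ B≢[] _ = ⊥-elim (B≢[] refl)
suffix-shorter (x ∷ B) R _ refl =
  s≤s (subst (length R ≤_) (sym (length-++ B)) (m≤n+m (length R) (length B)))

Settles : List Entry → List Entry → Set
Settles prev rest = count₁ prev + count₁ rest ≡ count₂ rest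

NoBalancedSuffix : List Entry → Set
NoBalancedSuffix l = ∀ P R → P ++ R ≡ l → NonEmpty R → ¬ Balanced R

record BlockInvariant (prev rest : List Entry) : Set where
  constructor _,_
  field
    noBalancedSuffix : NoBalancedSuffix rest
    settles          : Settles prev rest

settles-++ : ∀ prev B R → Settles prev (B ++ R) → count₂ B ≡ count₁ prev → Settles B R
settles-++ prev B R settles count₂B≡ = +-cancelˡ-≡ (count₁ prev) _ _ (begin
  count₁ prev + (count₁ B + count₁ R)  ≡⟨ cong (count₁ prev +_) (count₁-++ B R) ⟨
  count₁ prev + count₁ (B ++ R)        ≡⟨ settles ⟩
  count₂ (B ++ R)                      ≡⟨ count₂-++ B R ⟩
  count₂ B + count₂ R                  ≡⟨ cong (_+ count₂ R) count₂B≡ ⟩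
  count₁ prev + count₂ R               ∎)

noBalancedSuffix-++ : ∀ B {R} → NoBalancedSuffix (B ++ R) → NoBalancedSuffix R
noBalancedSuffix-++ B noBal P R′ P++R′≡R =
  noBal (B ++ P) R′ (trans (++-assoc B P R′) (cong (B ++_) P++R′≡R))

blockInvariant-step : ∀ {prev rest} B R → BlockInvariant prev rest →
                      LongestPrefix (count₁ prev) rest B R → BlockInvariant B R
blockInvariant-step {prev} B R (noBal , settles) (B++R≡rest , count₂B≡ , _) =
  noBalancedSuffix-++ B (subst NoBalancedSuffix (sym B++R≡rest) noBal) ,
  settles-++ prev B R (subst (Settles prev) (sym B++R≡rest) settles) count₂B≡

blockInvariant-count₁≢0 : ∀ {prev rest} → BlockInvariant prev rest → NonEmpty rest →
                          count₁ prev ≢ 0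
blockInvariant-count₁≢0 {rest = rest} (noBal , settles) rest≢[] count₁≡0 =
  noBal [] rest refl rest≢[] (subst (λ k → k + count₁ rest ≡ count₂ rest) count₁≡0 settles)

blockInvariant-[] : ∀ {prev} → BlockInvariant prev [] → count₁ prev ≡ 0
blockInvariant-[] (_ , settles) = trans (sym (+-identityʳ _)) settles

nextBlock : ∀ {prev rest} → BlockInvariant prev rest → ∃₂ (LongestPrefix (count₁ prev) rest)
nextBlock {prev} {rest} (_ , settles) =
  longestPrefix (count₁ prev) rest (subst (count₁ prev ≤_) settles (m≤m+n _ _))

lastBlock : List Entry → List (List Entry) → List Entry
lastBlock prev [] = prev
lastBlock _ (B ∷ Bs) = lastBlock B Bs

∷-lastBlock : ∀ prev Bs → ∃ λ Bs′ → prev ∷ Bs ≡ Bs′ ∷ʳ lastBlock prev Bs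
∷-lastBlock prev [] = [] , refl
∷-lastBlock prev (B ∷ Bs) with ∷-lastBlock B Bs
... | Bs′ , eq = prev ∷ Bs′ , cong (prev ∷_) eq

nextBlock-nonEmpty : ∀ {prev e rest} B R → BlockInvariant prev (e ∷ rest) →
                     LongestPrefix (count₁ prev) (e ∷ rest) B R → NonEmpty B
nextBlock-nonEmpty B R inv lp =
  longestPrefix-nonEmpty B R lp (blockInvariant-count₁≢0 inv (λ ()))

blocksFrom-sound : ∀ {prev rest Bs} → BlockInvariant prev rest → BlocksFrom prev rest Bs →
                   concat Bs ≡ rest × All NonEmpty Bs × count₁ (lastBlock prev Bs) ≡ 0
blocksFrom-sound inv stop = refl , [] , blockInvariant-[] inv
blocksFrom-sound inv (step {B = B} {rest' = R} lp bs)
  with blocksFrom-sound (blockInvariant-step B R inv lp) bs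
... | concat≡ , nonEmpty , last≡0 =
  trans (cong (B ++_) concat≡) (proj₁ lp) ,
  nextBlock-nonEmpty B R inv lp ∷ nonEmpty ,
  last≡0

blocksFrom-exists : ∀ {prev rest} → BlockInvariant prev rest → Acc ℕ._<_ (length rest) →
                    ∃ (BlocksFrom prev rest)
blocksFrom-exists {rest = []} _ _ = [] , stop
blocksFrom-exists {rest = e ∷ rest} inv (acc shorter) with nextBlock inv
... | B , R , lp
  with blocksFrom-exists (blockInvariant-step B R inv lp)
         (shorter (suffix-shorter B R (nextBlock-nonEmpty B R inv lp) (proj₁ lp)))
... | Bs , bs = B ∷ Bs , step lp bs

splitLeadingOnes : ∀ τ → Σ (List Entry) λ B₁ → Σ (List Entry) λ r →
                   B₁ ++ r ≡ τ × All (_≡ one) B₁ × NotStartingWithOne r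
splitLeadingOnes [] = [] , [] , refl , [] , tt
splitLeadingOnes (one ∷ τ) with splitLeadingOnes τ
... | B₁ , r , B₁++r≡τ , ones , notOne =
  one ∷ B₁ , r , cong (one ∷_) B₁++r≡τ , refl ∷ ones , notOne
splitLeadingOnes (two ∷ τ) = [] , two ∷ τ , refl , [] , λ ()
splitLeadingOnes (three ∷ τ) = [] , three ∷ τ , refl , [] , λ ()

count₂-allOnes : ∀ {B} → All (_≡ one) B → count₂ B ≡ 0
count₂-allOnes [] = refl
count₂-allOnes (refl ∷ ones) = count₂-allOnes ones

count₁-allOnes≢0 : ∀ {B} → All (_≡ one) B → NonEmpty B → count₁ B ≢ 0
count₁-allOnes≢0 [] B≢[] = ⊥-elim (B≢[] refl)
count₁-allOnes≢0 (refl ∷ _) _ ()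

firstBlock-nonEmpty : ∀ {τ B₁ r} → Primary τ → B₁ ++ r ≡ τ → NotStartingWithOne r →
                      NonEmpty B₁
firstBlock-nonEmpty {[]} {[]} () refl _ refl
firstBlock-nonEmpty {_ ∷ _} {[]} τ₁≡one refl notOne refl = notOne τ₁≡one

irreducible⇒noBalancedSuffix : ∀ {τ} P r → IsType τ → Irreducible τ → P ++ r ≡ τ →
                               NonEmpty P → NoBalancedSuffix r
irreducible⇒noBalancedSuffix {τ} P r ty (_ , irreducible) P++r≡τ P≢[]
                             P′ R P′++R≡r R≢[] balR =
  irreducible (P ++ P′ , R , balanced⇒isType balPP′ , PP′≢[] ,
               balanced⇒isType balR , R≢[] , τ≡)
  where
  τ≡ : τ ≡ (P ++ P′) ++ R
  τ≡ = begin
    τ                ≡⟨ P++r≡τ ⟨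
    P ++ r           ≡⟨ cong (P ++_) P′++R≡r ⟨
    P ++ (P′ ++ R)   ≡⟨ ++-assoc P P′ R ⟨
    (P ++ P′) ++ R   ∎
  balPP′ : Balanced (P ++ P′)
  balPP′ = balanced-++-cancelʳ (P ++ P′) R (subst Balanced τ≡ (isType⇒balanced ty)) balR
  PP′≢[] : NonEmpty (P ++ P′)
  PP′≢[] PP′≡[] = P≢[] (++-conicalˡ P P′ PP′≡[])

firstBlock-invariant : ∀ {τ B₁ r} → IsType τ → Primary τ → Irreducible τ →
                       B₁ ++ r ≡ τ → All (_≡ one) B₁ → NotStartingWithOne r →
                       NonEmpty B₁ × BlockInvariant B₁ r
firstBlock-invariant {τ} {B₁} {r} ty primary irreducible B₁++r≡τ ones notOne =
  B₁≢[] , irreducible⇒noBalancedSuffix B₁ r ty irreducible B₁++r≡τ B₁≢[] , settles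
  where
  B₁≢[] : NonEmpty B₁
  B₁≢[] = firstBlock-nonEmpty primary B₁++r≡τ notOne
  settles : Settles B₁ r
  settles = begin
    count₁ B₁ + count₁ r   ≡⟨ count₁-++ B₁ r ⟨
    count₁ (B₁ ++ r)       ≡⟨ subst Balanced (sym B₁++r≡τ) (isType⇒balanced ty) ⟩
    count₂ (B₁ ++ r)       ≡⟨ count₂-++ B₁ r ⟩
    count₂ B₁ + count₂ r   ≡⟨ cong (_+ count₂ r) (count₂-allOnes ones) ⟩
    count₂ r               ∎

atLeastTwoBlocks : ∀ {B₁} Bs → count₁ B₁ ≢ 0 → count₁ (lastBlock B₁ Bs) ≡ 0 →
                   2 ≤ length (B₁ ∷ Bs)
atLeastTwoBlocks [] count₁≢0 count₁≡0 = ⊥-elim (count₁≢0 count₁≡0)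
atLeastTwoBlocks (_ ∷ _) _ _ = s≤s (s≤s z≤n)

fact2p1 : (τ : List Entry) → IsType τ → Primary τ → Irreducible τ →
    (∃ λ Bs → BlockAlgorithm τ Bs) ×
    (∀ Bs → BlockAlgorithm τ Bs →
      concat Bs ≡ τ × All NonEmpty Bs × 2 ≤ length Bs ×
      (Σ (List (List Entry)) λ Bs′ → Σ (List Entry) λ B →
         Bs ≡ Bs′ ∷ʳ B × count₁ B ≡ 0))
fact2p1 τ ty primary irreducible =
  existence ,
  λ { _ (run {B₁} {r} {Bs} B₁++r≡τ ones notOne bs) →
    let (B₁≢[] , inv) = firstBlock-invariant ty primary irreducible B₁++r≡τ ones notOne
        (concat≡r , nonEmpty , last≡0) = blocksFrom-sound inv bs
        (Bs′ , snoc) = ∷-lastBlock B₁ Bs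
    in trans (cong (B₁ ++_) concat≡r) B₁++r≡τ , B₁≢[] ∷ nonEmpty ,
       atLeastTwoBlocks Bs (count₁-allOnes≢0 ones B₁≢[]) last≡0 ,
       Bs′ , lastBlock B₁ Bs , snoc , last≡0 }
  where
  existence : ∃ (BlockAlgorithm τ)
  existence with splitLeadingOnes τ
  ... | B₁ , r , B₁++r≡τ , ones , notOne
    with firstBlock-invariant ty primary irreducible B₁++r≡τ ones notOne
  ... | _ , inv with blocksFrom-exists inv (<-wellFounded (length r))
  ... | Bs , bs = B₁ ∷ Bs , run B₁++r≡τ ones notOne bs
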